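{- Let $B$ be a type. For all $f:\mathbb{N}\to B^\nu$ and $b:B$, if $\mathsf{parallel\_search}\,f\downarrow b$ then there exists $n:\mathbb{N}$ with $f\,n\downarrow b$.
   Context: Work in an intensional constructive dependent type theory with inductive and coinductive types. For a type $B$, $B^\nu$ is the coinductive type with constructors $\mathsf{return}:B\to B^\nu$ and $\mathsf{step}:B^\nu\to B^\nu$; $\mathsf{step}^\infty=\mathsf{step}\,\mathsf{step}^\infty$. Convergence $x\downarrow b$ is inductive: $\mathsf{return}\,b\downarrow b$; $x\downarrow b\Rightarrow\mathsf{step}\,x\downarrow b$. $\mathsf{fstconv}:B^\nu\to B^\nu\to B^\nu$ is defined corecursively by $\mathsf{fstconv}\,(\mathsf{return}\,b)\,y=\mathsf{return}\,b$; $\mathsf{fstconv}\,(\mathsf{step}\,x)\,(\mathsf{return}\,b)=\mathsf{return}\,b$; $\mathsf{fstconv}\,(\mathsf{step}\,x)\,(\mathsf{step}\,y)=\mathsf{step}(\mathsf{fstconv}\,x\,y)$. $\mathsf{psa}:(\mathbb{N}\to B^\nu)\to\mathbb{N}\to B^\nu\to B^\nu$ is defined corecursively by $\mathsf{psa}\,f\,n\,(\mathsf{return}\,b)=\mathsf{return}\,b$ and $\mathsf{psa}\,f\,n\,(\mathsf{step}\,x)=\mathsf{step}(\mathsf{psa}\,f\,(n+1)\,(\mathsf{fstconv}\,x\,(f\,n)))$, and $\mathsf{parallel\_search}\,f=\mathsf{psa}\,f\,0\,\mathsf{step}^\infty$. -}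

module Defs where

-- We therefore represent the
-- coinductive type B^ν (constructors return : B → B^ν, step : B^ν → B^ν) by
-- its standard observational encoding as a sequence of observations:
--
--   x : ℕ → Maybe B
--
-- read as follows:  x 0 ≡ just b   means  x = return b,
--                   x 0 ≡ nothing  means  x = step (x ∘ suc).
-- (Values after the first `just` are never observed.)  Every corecursive
-- definition below is the literal unfolding of the corecursive equations
-- of the paper through this reading.

open import Data.Nat using (ℕ; zero; suc)
open import Data.Maybe using (Maybe; just; nothing)
open import Relation.Binary.PropositionalEquality using (_≡_)

Delay : ∀ {a} → Set a → Set a
Delay B = ℕ → Maybe B

module _ {a} {B : Set a} where

  return : B → Delay B
  return b _ = just b

  step : Delay B → Delay B
  step x zero    = nothing
  step x (suc n) = x n

  later : Delay B → Delay B
  later x n = x (suc n)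

  step∞ : Delay B
  step∞ _ = nothing

  data _↓_ : Delay B → B → Set a where
    ↓-return : ∀ {x b} → x zero ≡ just b → x ↓ b
    ↓-step   : ∀ {x b} → x zero ≡ nothing → later x ↓ b → x ↓ b

  -- fstconv (return b) y              = return b
  -- fstconv (step x)   (return b)     = return b
  -- fstconv (step x)   (step y)       = step (fstconv x y)
  fstconv : Delay B → Delay B → Delay B
  fstconv x y n with x zero | y zero
  fstconv x y n       | just b  | _       = just b
  fstconv x y n       | nothing | just b  = just b
  fstconv x y zero    | nothing | nothing = nothing
  fstconv x y (suc n) | nothing | nothing = fstconv (later x) (later y) n

  -- psa f n (return b) = return b
  -- psa f n (step x)   = step (psa f (n+1) (fstconv x (f n)))
  psa : (ℕ → Delay B) → ℕ → Delay B → Delay B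
  psa f k x m with x zero
  psa f k x m       | just b  = just b
  psa f k x zero    | nothing = nothing
  psa f k x (suc m) | nothing = psa f (suc k) (fstconv (later x) (f k)) m

  parallel-search : (ℕ → Delay B) → Delay B
  parallel-search f = psa f zero step∞

module Submission where

-- parallel_search f is psa started from step^∞, and each step of psa replaces
-- its state x by fstconv x (f k). As fstconv only returns a value returned by
-- one of its arguments, a value found by the search was returned either by the
-- state or by some f k; tracing the state back, it ends at step^∞, which never
-- converges.
-- The inductions run over derivations of z ↓ b for any z pointwise equal to the
-- delay of interest, because the tail of fstconv x y (resp. psa f k x) is only
-- pointwise, not definitionally, equal to its corecursive unfolding.

open import Defs
open import Data.Nat using (ℕ; zero; suc)
open import Data.Maybe using (just; nothing)
open import Data.Product using (∃; _×_; _,_)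
open import Data.Sum using (_⊎_; inj₁; inj₂)
import Data.Sum as Sum
open import Data.Empty using (⊥-elim)
open import Relation.Nullary using (¬_)
open import Relation.Binary.PropositionalEquality using (_≡_; refl; sym; trans)

module _ {a} {B : Set a} where

  infix 4 _≈_

  _≈_ : Delay B → Delay B → Set a
  x ≈ y = ∀ n → x n ≡ y n

  fstconv-now : ∀ (x y : Delay B) {b} → fstconv x y zero ≡ just b →
                x zero ≡ just b ⊎ y zero ≡ just b
  fstconv-now x y p with x zero | y zero
  ... | just c  | _      = inj₁ p
  ... | nothing | just c = inj₂ p

  fstconv-pending : ∀ (x y : Delay B) → fstconv x y zero ≡ nothing →
                    x zero ≡ nothing × y zero ≡ nothing
  fstconv-pending x y p with x zero | y zero
  ... | nothing | nothing = refl , refl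

  later-fstconv : ∀ (x y : Delay B) → x zero ≡ nothing → y zero ≡ nothing →
                  later (fstconv x y) ≈ fstconv (later x) (later y)
  later-fstconv x y ex ey n rewrite ex | ey = refl

  psa-now : ∀ f k (x : Delay B) {b} → psa f k x zero ≡ just b → x zero ≡ just b
  psa-now f k x p with x zero
  ... | just c = p

  psa-pending : ∀ f k (x : Delay B) → psa f k x zero ≡ nothing → x zero ≡ nothing
  psa-pending f k x p with x zero
  ... | nothing = refl

  later-psa : ∀ f k (x : Delay B) → x zero ≡ nothing →
              later (psa f k x) ≈ psa f (suc k) (fstconv (later x) (f k))
  later-psa f k x ex n rewrite ex = refl

  ↓-fstconv : ∀ (x y : Delay B) {z b} → z ≈ fstconv x y → z ↓ b → x ↓ b ⊎ y ↓ b
  ↓-fstconv x y e (↓-return p) =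
    Sum.map ↓-return ↓-return (fstconv-now x y (trans (sym (e zero)) p))
  ↓-fstconv x y e (↓-step p d) with fstconv-pending x y (trans (sym (e zero)) p)
  ... | ex , ey =
    Sum.map (↓-step ex) (↓-step ey)
      (↓-fstconv (later x) (later y) (λ n → trans (e (suc n)) (later-fstconv x y ex ey n)) d)

  ↓-psa : ∀ (f : ℕ → Delay B) k x {z b} → z ≈ psa f k x → z ↓ b →
          x ↓ b ⊎ ∃ λ n → f n ↓ b
  ↓-psa f k x e (↓-return p) = inj₁ (↓-return (psa-now f k x (trans (sym (e zero)) p)))
  ↓-psa f k x e (↓-step p d) with psa-pending f k x (trans (sym (e zero)) p)
  ... | ex with ↓-psa f (suc k) _ (λ n → trans (e (suc n)) (later-psa f k x ex n)) d
  ...   | inj₂ found = inj₂ found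
  ...   | inj₁ d′    = Sum.map (↓-step ex) (k ,_) (↓-fstconv (later x) (f k) (λ _ → refl) d′)

  step∞-diverges : ∀ {z : Delay B} {b} → z ≈ step∞ → ¬ z ↓ b
  step∞-diverges e (↓-return p) with trans (sym (e zero)) p
  ... | ()
  step∞-diverges e (↓-step _ d) = step∞-diverges (λ n → e (suc n)) d

lemma6p13 : ∀ {a} {B : Set a} (f : ℕ → Delay B) (b : B) →
    parallel-search f ↓ b → ∃ λ n → f n ↓ b
lemma6p13 f b d with ↓-psa f zero step∞ (λ _ → refl) d
... | inj₁ d∞    = ⊥-elim (step∞-diverges (λ _ → refl) d∞)
... | inj₂ found = found
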